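{- Let $N=\{1,\ldots,n\}$ and let $v$ be a bi-cooperative game on $N$ with M\"obius transform $m$. For every $(S,T)\in\mathcal{Q}(N)$ (writing $s=|S|$, $t=|T|$, $t'=|T'|$), \[ I^v_{S,T}=\sum_{(S',T')\in\uparrow\big(\bigsqcup_{i\in S}(\{i\},N\setminus\{i\})\sqcup\bigsqcup_{j\in T}(\emptyset,N\setminus\{j\})\big)\cap\mathcal{Q}(N\setminus T)}\frac{m(S',T')}{n-s-t-t'+1} =\sum_{(S',T')\in[(S,N\setminus(S\cup T)),(N\setminus T,\emptyset)]}\frac{m(S',T')}{n-s-t-t'+1}. \]
   Context: $\mathcal{Q}(N)=\{(A,B)\in 2^N\times 2^N : A\cap B=\emptyset\}$ (similarly $\mathcal{Q}(M)$ for $M\subseteq N$), ordered by $(A,B)\sqsubseteq(C,D)$ iff $A\subseteq C$ and $B\supseteq D$, with join $(A,B)\sqcup(C,D)=(A\cup C,B\cap D)$; $\uparrow x=\{z\in\mathcal{Q}(N): x\sqsubseteq z\}$, $[x,y]=\{z: x\sqsubseteq z\sqsubseteq y\}$. A bi-cooperative game is any $v:\mathcal{Q}(N)\to\mathbb{R}$ with $v(\emptyset,\emptyset)=0$; its M\"obius transform is the unique $m$ with $v(A,A')=\sum_{(B,B')\sqsubseteq(A,A')}m(B,B')$. For $(S,T)\in\mathcal{Q}(N)$ and $(K,L)\in\mathcal{Q}(N\setminus S)$ with $L\supseteq T$, $\Delta_{S,T}v(K,L)=\sum_{S'\subseteq S,\,T'\subseteq T}(-1)^{(s-s')+(t-t')}v(K\cup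 S',L\setminus T')$ (so $\Delta_{\emptyset,\emptyset}v=v$). The interaction index is defined for all $(S,T)\in\mathcal{Q}(N)$ (including $(\emptyset,\emptyset)$) by $I^v_{S,T}=\sum_{K\subseteq N\setminus(S\cup T)}\frac{(n-s-t-k)!k!}{(n-s-t+1)!}\Delta_{S,T}v(K,N\setminus(K\cup S))$, with $k=|K|$.
   Formalization: The bi-cooperative game v and its Möbius transform m take values in ℚ rather than ℝ. -}

module Defs where

open import Data.Nat as ℕ using (ℕ; zero; suc; _∸_; _!)
open import Data.Nat.Properties using (_!≢0)
open import Data.Integer using (+_)
open import Data.Bool using (Bool; true; false)
open import Data.Bool.Properties using () renaming (_≟_ to _≟ᵇ_)
open import Data.Fin using (Fin)
open import Data.Fin.Subset
  using (Subset; ⊥; ⊤; ∁; _∩_; _∪_; _─_; ⁅_⁆; _⊆_; ∣_∣; _∈_; inside; outside)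
open import Data.Fin.Subset.Properties using (_⊆?_; _∈?_)
open import Data.Vec using (Vec; []; _∷_)
open import Data.Vec.Properties using (≡-dec)
open import Data.List using (List; []; _∷_; map; filter; foldr; concatMap; _++_; allFin)
open import Data.Product using (_×_; _,_; proj₁; proj₂)
open import Data.Rational using (ℚ; 0ℚ; 1ℚ; _+_; _*_; -_; _/_)
open import Relation.Binary.PropositionalEquality using (_≡_)
open import Relation.Nullary using (Dec; yes; no)
open import Relation.Nullary.Decidable using (_×-dec_)
open import Relation.Unary using (Decidable)

allSubsets : ∀ n → List (Subset n)
allSubsets zero = [] ∷ []
allSubsets (suc n) =
  map (outside ∷_) (allSubsets n) ++ map (inside ∷_) (allSubsets n)

elems : ∀ {n} → Subset n → List (Fin n)
elems {n} S = filter (_∈? S) (allFin n)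

Disjoint : ∀ {n} → Subset n → Subset n → Set
Disjoint A B = A ∩ B ≡ ⊥

disjoint? : ∀ {n} (A B : Subset n) → Dec (Disjoint A B)
disjoint? A B = ≡-dec _≟ᵇ_ (A ∩ B) ⊥

Pair : ℕ → Set
Pair n = Subset n × Subset n

InQ : ∀ {n} → Pair n → Set
InQ (A , B) = Disjoint A B

inQ? : ∀ {n} → Decidable (InQ {n})
inQ? (A , B) = disjoint? A B

_⊑_ : ∀ {n} → Pair n → Pair n → Set
(A , B) ⊑ (C , D) = (A ⊆ C) × (D ⊆ B)

_⊑?_ : ∀ {n} (x y : Pair n) → Dec (x ⊑ y)
(A , B) ⊑? (C , D) = (A ⊆? C) ×-dec (D ⊆? B)

_⊔_ : ∀ {n} → Pair n → Pair n → Pair n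
(A , B) ⊔ (C , D) = (A ∪ C , B ∩ D)

⊥Q : ∀ {n} → Pair n
⊥Q = (⊥ , ⊤)

⨆ : ∀ {n} → List (Pair n) → Pair n
⨆ = foldr _⊔_ ⊥Q

InQOn : ∀ {n} → Subset n → Pair n → Set
InQOn M (A , B) = (A ⊆ M) × (B ⊆ M) × Disjoint A B

inQOn? : ∀ {n} (M : Subset n) → Decidable (InQOn M)
inQOn? M (A , B) = (A ⊆? M) ×-dec ((B ⊆? M) ×-dec disjoint? A B)

allPairs : ∀ n → List (Pair n)
allPairs n = concatMap (λ A → map (A ,_) (allSubsets n)) (allSubsets n)

sumℚ : List ℚ → ℚ
sumℚ = foldr _+_ 0ℚ

sumOver : ∀ {n} {P : Pair n → Set} → Decidable P → (Pair n → ℚ) → ℚ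
sumOver {n} P? f = sumℚ (map f (filter P? (allPairs n)))

-- Games: functions on pairs of subsets (only values on Q(N) matter).
Game : ℕ → Set
Game n = Subset n → Subset n → ℚ

IsBiCoopGame : ∀ {n} → Game n → Set
IsBiCoopGame v = v ⊥ ⊥ ≡ 0ℚ

IsMobius : ∀ {n} → Game n → Game n → Set
IsMobius {n} v m =
  ∀ A A' → Disjoint A A' →
    v A A' ≡ sumOver (λ x → inQ? x ×-dec (x ⊑? (A , A'))) (λ x → m (proj₁ x) (proj₂ x))

sign : ℕ → ℚ
sign zero = 1ℚ
sign (suc k) = - sign k

Δ : ∀ {n} → Subset n → Subset n → Game n → Subset n → Subset n → ℚ
Δ {n} S T v K L =
  sumOver (λ x → (proj₁ x ⊆? S) ×-dec (proj₂ x ⊆? T))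
    (λ x → sign ((∣ S ∣ ∸ ∣ proj₁ x ∣) ℕ.+ (∣ T ∣ ∸ ∣ proj₂ x ∣))
           * v (K ∪ proj₁ x) (L ─ proj₂ x))

coefI : ℕ → ℕ → ℕ → ℕ → ℚ
coefI n s t k = (+ ((n ∸ s ∸ t ∸ k) ! ℕ.* k !)) / (suc (n ∸ s ∸ t)) !
  where instance _ = (suc (n ∸ s ∸ t)) !≢0

interaction : ∀ {n} → Game n → Subset n → Subset n → ℚ
interaction {n} v S T =
  sumℚ (map (λ K → coefI n (∣ S ∣) (∣ T ∣) (∣ K ∣) * Δ S T v K (∁ (K ∪ S)))
            (filter (_⊆? ∁ (S ∪ T)) (allSubsets n)))

-- Summand m(S',T') / (n - s - t - t' + 1)   (the denominator is ≥ 1 on the summation range).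
term : ∀ {n} → Game n → Subset n → Subset n → Pair n → ℚ
term {n} m S T (S' , T') = m S' T' * ((+ 1) / suc (n ∸ ∣ S ∣ ∸ ∣ T ∣ ∸ ∣ T' ∣))

module Submission where

-- Expanding v by its Möbius transform m, the difference operator Δ_{S,T} is an alternating sum over the
-- Boolean lattices below S and T, so by the Möbius function of the Boolean lattice the term m(B,B′) survives
-- in Δ_{S,T} v(K, N∖(K∪S)) exactly when B∖K = S and (N∖(K∪S))∖B′ = T.  For a disjoint pair (B,B′) and
-- K ⊆ N∖(S∪T) this says that (B,B′) lies in the interval [(S, N∖(S∪T)), (N∖T, ∅)] and N∖(S∪T∪B′) ⊆ K.  The weights
-- (m′−k)! k!/(m′+1)! of the interaction index are Beta integrals ∫₀¹ xᵏ(1−x)^{m′−k} dx, so summing them over that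
-- range of K leaves ∫₀¹ x^r dx = 1/(r+1) with r = n−s−t−t′.  The join of the generators is (S, N∖(S∪T)), which
-- turns the upper set in Q(N∖T) into the same interval.

open import Defs
open import Data.Nat using (ℕ; zero; suc; _∸_; _!; _≤_; z≤n; s≤s)
import Data.Nat as ℕ
import Data.Nat.Properties as ℕ
import Data.Nat.Solver as ℕ-Solver
open import Data.Integer using () renaming (+_ to ⁺_)
import Data.Integer as ℤ
import Data.Integer.Properties as ℤ
open import Data.Rational using (ℚ; 0ℚ; 1ℚ; _+_; _*_; -_; _/_; toℚᵘ)
open import Data.Rational.Properties
import Data.Rational.Solver as ℚ-Solver
open import Data.Rational.Unnormalised.Base as ℚᵘ using (mkℚᵘ; *≡*)
import Data.Rational.Unnormalised.Properties as ℚᵘ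
open import Data.Bool using (Bool; true; false; _∧_)
open import Data.Bool.Properties using (∧-identityʳ; ∧-commutativeMonoid) renaming (_≟_ to _≟ᵇ_)
import Data.Fin as Fin
open Fin using (Fin)
open import Data.Vec using ([]; _∷_; [_]; head; tail)
open import Data.Vec.Properties using (≡-dec; ∷-injective)
open import Data.Fin.Subset using (Subset; ⊥; ∁; _∪_; _∩_; _─_; ⁅_⁆; _⊆_; ∣_∣; outside; inside)
open import Data.Fin.Subset.Properties
  using (_⊆?_; _∈?_; ⊥⊆; ⊆-trans; p⊆p∪q; q⊆p∪q; p⊆q⇒∁p⊇∁q; p─q⊆p; x∈p∩q⁻; x∈p∪q⁻; x∈p∪q⁺; x∈p⇒x∉∁p;
         Empty-unique; p⊆q⇒∣p∣≤∣q∣; ∣∁p∣≡n∸∣p∣; ∪-comm; ∪-identityˡ; ∪-identityʳ; ∩-identityˡ; ∪-∩-booleanAlgebra)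
import Algebra.Lattice.Properties.BooleanAlgebra as BooleanAlgebraProperties
open import Data.List using (List; map; filter; _++_; concatMap; allFin; tabulate)
import Data.List.Properties as List
open import Data.Product using (_×_; _,_; proj₁; proj₂)
open import Data.Sum using (inj₁; inj₂; [_,_]′)
open import Function using (id; _∘_)
open import Algebra.Bundles using (CommutativeMonoid)
open import Relation.Binary.Definitions using (DecidableEquality)
open import Relation.Binary.PropositionalEquality using (_≡_; refl; sym; trans; cong; cong₂; subst; module ≡-Reasoning)
open import Relation.Nullary using (Dec; does; yes; no)
open import Relation.Nullary.Decidable using (_×-dec_; dec-true)
open import Relation.Unary using (Decidable; _≐_)

χ : Bool → ℚ
χ true  = 1ℚ
χ false = 0ℚ

⟦_⟧ : ∀ {p} {P : Set p} → Dec P → ℚ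
⟦ d ⟧ = χ (does d)

⟦⟧-under : ∀ {p} {P : Set p} (d : Dec P) {x y : ℚ} → (P → x ≡ y) → ⟦ d ⟧ * x ≡ ⟦ d ⟧ * y
⟦⟧-under (yes p) x≡y = cong (1ℚ *_) (x≡y p)
⟦⟧-under (no _)  {x} {y} _ = trans (*-zeroˡ x) (sym (*-zeroˡ y))

χ-∧ : ∀ a b → χ (a ∧ b) ≡ χ a * χ b
χ-∧ true  b = sym (*-identityˡ (χ b))
χ-∧ false b = sym (*-zeroˡ (χ b))

∑ : ∀ n → (Subset n → ℚ) → ℚ
∑ zero    f = f []
∑ (suc n) f = ∑ n (λ A → f (outside ∷ A)) + ∑ n (λ A → f (inside ∷ A))

∑² : ∀ n → (Subset n → Subset n → ℚ) → ℚ
∑² n f = ∑ n λ A → ∑ n λ B → f A B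

∑-cong : ∀ n {f g : Subset n → ℚ} → (∀ A → f A ≡ g A) → ∑ n f ≡ ∑ n g
∑-cong zero    f≗g = f≗g []
∑-cong (suc n) f≗g =
  cong₂ _+_ (∑-cong n (λ A → f≗g (outside ∷ A))) (∑-cong n (λ A → f≗g (inside ∷ A)))

∑²-cong : ∀ n {f g : Subset n → Subset n → ℚ} → (∀ A B → f A B ≡ g A B) → ∑² n f ≡ ∑² n g
∑²-cong n f≗g = ∑-cong n (λ A → ∑-cong n (f≗g A))

∑-distrib-+ : ∀ n (f g : Subset n → ℚ) → ∑ n (λ A → f A + g A) ≡ ∑ n f + ∑ n g
∑-distrib-+ zero    f g = refl
∑-distrib-+ (suc n) f g = trans
  (cong₂ _+_ (∑-distrib-+ n f₀ g₀) (∑-distrib-+ n f₁ g₁))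
  (+-interchange (∑ n f₀) (∑ n g₀) (∑ n f₁) (∑ n g₁))
  where
  f₀ f₁ g₀ g₁ : Subset n → ℚ
  f₀ A = f (outside ∷ A)
  f₁ A = f (inside ∷ A)
  g₀ A = g (outside ∷ A)
  g₁ A = g (inside ∷ A)
  open import Algebra.Properties.CommutativeSemigroup (CommutativeMonoid.commutativeSemigroup +-0-commutativeMonoid)
          using () renaming (interchange to +-interchange)

∑-neg : ∀ n (f : Subset n → ℚ) → ∑ n (λ A → - f A) ≡ - ∑ n f
∑-neg zero    f = refl
∑-neg (suc n) f = trans
  (cong₂ _+_ (∑-neg n (λ A → f (outside ∷ A))) (∑-neg n (λ A → f (inside ∷ A))))
  (sym (neg-distrib-+ (∑ n (λ A → f (outside ∷ A))) (∑ n (λ A → f (inside ∷ A)))))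

∑-*ˡ : ∀ n c (f : Subset n → ℚ) → c * ∑ n f ≡ ∑ n (λ A → c * f A)
∑-*ˡ zero    c f = refl
∑-*ˡ (suc n) c f = trans (*-distribˡ-+ c _ _)
  (cong₂ _+_ (∑-*ˡ n c (λ A → f (outside ∷ A))) (∑-*ˡ n c (λ A → f (inside ∷ A))))

∑-*ʳ : ∀ n c (f : Subset n → ℚ) → ∑ n f * c ≡ ∑ n (λ A → f A * c)
∑-*ʳ n c f = trans (*-comm (∑ n f) c) (trans (∑-*ˡ n c f) (∑-cong n (λ A → *-comm c (f A))))

0*x*y≡0 : ∀ x y → 0ℚ * x * y ≡ 0ℚ
0*x*y≡0 x y = trans (cong (_* y) (*-zeroˡ x)) (*-zeroˡ y)

x*0*y≡0 : ∀ x y → x * 0ℚ * y ≡ 0ℚ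
x*0*y≡0 x y = trans (cong (_* y) (*-zeroʳ x)) (*-zeroˡ y)

x*[0*y]≡0 : ∀ x y → x * (0ℚ * y) ≡ 0ℚ
x*[0*y]≡0 x y = trans (cong (x *_) (*-zeroˡ y)) (*-zeroʳ x)

∑-zero : ∀ n {f : Subset n → ℚ} → (∀ A → f A ≡ 0ℚ) → ∑ n f ≡ 0ℚ
∑-zero zero    f≗0 = f≗0 []
∑-zero (suc n) f≗0 = trans
  (cong₂ _+_ (∑-zero n (λ A → f≗0 (outside ∷ A))) (∑-zero n (λ A → f≗0 (inside ∷ A))))
  (+-identityˡ 0ℚ)

∑-comm : ∀ n m (f : Subset n → Subset m → ℚ) →
  ∑ n (λ A → ∑ m (f A)) ≡ ∑ m (λ B → ∑ n (λ A → f A B))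
∑-comm zero    m f = refl
∑-comm (suc n) m f = trans
  (cong₂ _+_ (∑-comm n m (λ A → f (outside ∷ A))) (∑-comm n m (λ A → f (inside ∷ A))))
  (sym (∑-distrib-+ m _ _))

∑²-comm : ∀ n (f : Subset n → Subset n → Subset n → Subset n → ℚ) →
  ∑² n (λ A B → ∑² n (f A B)) ≡ ∑² n (λ C D → ∑² n (λ A B → f A B C D))
∑²-comm n f = begin
  ∑ n (λ A → ∑ n λ B → ∑ n λ C → ∑ n λ D → f A B C D)
    ≡⟨ ∑-cong n (λ A → ∑-comm n n (λ B C → ∑ n (f A B C))) ⟩
  ∑ n (λ A → ∑ n λ C → ∑ n λ B → ∑ n λ D → f A B C D)
    ≡⟨ ∑-comm n n (λ A C → ∑ n λ B → ∑ n λ D → f A B C D) ⟩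
  ∑ n (λ C → ∑ n λ A → ∑ n λ B → ∑ n λ D → f A B C D)
    ≡⟨ ∑-cong n (λ C → ∑-cong n (λ A → ∑-comm n n (λ B D → f A B C D))) ⟩
  ∑ n (λ C → ∑ n λ A → ∑ n λ D → ∑ n λ B → f A B C D)
    ≡⟨ ∑-cong n (λ C → ∑-comm n n (λ A D → ∑ n λ B → f A B C D)) ⟩
  ∑ n (λ C → ∑ n λ D → ∑ n λ A → ∑ n λ B → f A B C D) ∎
  where open ≡-Reasoning

∑²-*ˡ : ∀ n c (f : Subset n → Subset n → ℚ) → c * ∑² n f ≡ ∑² n (λ A B → c * f A B)
∑²-*ˡ n c f = trans (∑-*ˡ n c _) (∑-cong n (λ A → ∑-*ˡ n c (f A)))

∑²-product : ∀ n (f g : Subset n → ℚ) → ∑² n (λ A B → f A * g B) ≡ ∑ n f * ∑ n g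
∑²-product n f g = begin
  ∑ n (λ A → ∑ n λ B → f A * g B) ≡⟨ ∑-cong n (λ A → sym (∑-*ˡ n (f A) g)) ⟩
  ∑ n (λ A → f A * ∑ n g)         ≡⟨ sym (∑-*ʳ n (∑ n g) f) ⟩
  ∑ n f * ∑ n g                   ∎
  where open ≡-Reasoning

sumℚ-++ : ∀ (xs ys : List ℚ) → sumℚ (xs ++ ys) ≡ sumℚ xs + sumℚ ys
sumℚ-++ List.[]       ys = sym (+-identityˡ _)
sumℚ-++ (x List.∷ xs) ys = trans (cong (x +_) (sumℚ-++ xs ys)) (sym (+-assoc x _ _))

sumℚ-map-filter : ∀ {A : Set} {P : A → Set} (P? : Decidable P) (f : A → ℚ) xs →
  sumℚ (map f (filter P? xs)) ≡ sumℚ (map (λ x → ⟦ P? x ⟧ * f x) xs)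
sumℚ-map-filter P? f List.[] = refl
sumℚ-map-filter P? f (x List.∷ xs) with does (P? x)
... | true  = cong₂ _+_ (sym (*-identityˡ (f x))) (sumℚ-map-filter P? f xs)
... | false = trans (sumℚ-map-filter P? f xs)
                    (trans (sym (+-identityˡ _)) (cong (_+ _) (sym (*-zeroˡ (f x)))))

sumℚ-map-cong : ∀ {A : Set} {f g : A → ℚ} → (∀ x → f x ≡ g x) → ∀ xs →
  sumℚ (map f xs) ≡ sumℚ (map g xs)
sumℚ-map-cong f≗g List.[]       = refl
sumℚ-map-cong f≗g (x List.∷ xs) = cong₂ _+_ (f≗g x) (sumℚ-map-cong f≗g xs)

sumℚ-map-++ : ∀ {A : Set} (f : A → ℚ) xs ys → sumℚ (map f (xs ++ ys)) ≡ sumℚ (map f xs) + sumℚ (map f ys)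
sumℚ-map-++ f xs ys = trans (cong sumℚ (List.map-++ f xs ys)) (sumℚ-++ (map f xs) (map f ys))

sumℚ-allSubsets : ∀ n (f : Subset n → ℚ) → sumℚ (map f (allSubsets n)) ≡ ∑ n f
sumℚ-allSubsets zero    f = +-identityʳ (f [])
sumℚ-allSubsets (suc n) f = begin
  sumℚ (map f (map (outside ∷_) (allSubsets n) ++ map (inside ∷_) (allSubsets n)))
    ≡⟨ sumℚ-map-++ f (map (outside ∷_) (allSubsets n)) _ ⟩
  sumℚ (map f (map (outside ∷_) (allSubsets n))) + sumℚ (map f (map (inside ∷_) (allSubsets n)))
    ≡⟨ cong₂ _+_ (cong sumℚ (sym (List.map-∘ (allSubsets n)))) (cong sumℚ (sym (List.map-∘ (allSubsets n)))) ⟩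
  sumℚ (map (λ A → f (outside ∷ A)) (allSubsets n)) + sumℚ (map (λ A → f (inside ∷ A)) (allSubsets n))
    ≡⟨ cong₂ _+_ (sumℚ-allSubsets n _) (sumℚ-allSubsets n _) ⟩
  ∑ (suc n) f ∎
  where open ≡-Reasoning

sumℚ-allPairs : ∀ n (f : Pair n → ℚ) → sumℚ (map f (allPairs n)) ≡ ∑² n (λ A B → f (A , B))
sumℚ-allPairs n f = trans (sumℚ-concatMap (allSubsets n)) (trans
  (sumℚ-map-cong (λ A → trans (cong sumℚ (sym (List.map-∘ (allSubsets n)))) (sumℚ-allSubsets n _)) (allSubsets n))
  (sumℚ-allSubsets n _))
  where
  pairsWith : Subset n → List (Pair n)
  pairsWith A = map (A ,_) (allSubsets n)
  sumℚ-concatMap : ∀ As → sumℚ (map f (concatMap pairsWith As)) ≡ sumℚ (map (λ A → sumℚ (map f (pairsWith A))) As)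
  sumℚ-concatMap List.[]       = refl
  sumℚ-concatMap (A List.∷ As) = trans (sumℚ-map-++ f (pairsWith A) _) (cong (sumℚ (map f (pairsWith A)) +_) (sumℚ-concatMap As))

sumOver-∑² : ∀ n {P : Pair n → Set} (P? : Decidable P) (f : Pair n → ℚ) →
  sumOver P? f ≡ ∑² n (λ A B → ⟦ P? (A , B) ⟧ * f (A , B))
sumOver-∑² n P? f = trans (sumℚ-map-filter P? f (allPairs n)) (sumℚ-allPairs n _)

-- Beta weights

/-cross : ∀ a b c d .{{_ : ℕ.NonZero b}} .{{_ : ℕ.NonZero d}} →
  a ℕ.* d ≡ c ℕ.* b → ⁺ a / b ≡ ⁺ c / d
/-cross a b@(suc b-1) c d@(suc d-1) ad≡cb = fromℚᵘ-cong {mkℚᵘ (⁺ a) b-1} {mkℚᵘ (⁺ c) d-1} (*≡* (begin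
  ⁺ a ℤ.* ⁺ d ≡⟨ ℤ.pos-* a d ⟨
  ⁺ (a ℕ.* d) ≡⟨ cong ⁺_ ad≡cb ⟩
  ⁺ (c ℕ.* b) ≡⟨ ℤ.pos-* c b ⟩
  ⁺ c ℤ.* ⁺ b ∎))
  where open ≡-Reasoning

/-+ : ∀ a b c d .{{_ : ℕ.NonZero b}} .{{_ : ℕ.NonZero d}} →
  ⁺ a / b + ⁺ c / d ≡ (⁺ (a ℕ.* d ℕ.+ c ℕ.* b) / (b ℕ.* d)) {{ℕ.m*n≢0 b d}}
/-+ a b@(suc _) c d@(suc _) = toℚᵘ-injective (begin-equality
  toℚᵘ (⁺ a / b + ⁺ c / d)                    ≃⟨ toℚᵘ-homo-+ (⁺ a / b) (⁺ c / d) ⟩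
  toℚᵘ (⁺ a / b) ℚᵘ.+ toℚᵘ (⁺ c / d)          ≃⟨ ℚᵘ.+-cong (toℚᵘ-fromℚᵘ (⁺ a ℚᵘ./ b)) (toℚᵘ-fromℚᵘ (⁺ c ℚᵘ./ d)) ⟩
  ⁺ a ℚᵘ./ b ℚᵘ.+ ⁺ c ℚᵘ./ d                  ≃⟨ ℚᵘ.≃-reflexive (cong₂ (λ x y → mkℚᵘ (x ℤ.+ y) _) (sym (ℤ.pos-* a d)) (sym (ℤ.pos-* c b))) ⟩
  ⁺ (a ℕ.* d ℕ.+ c ℕ.* b) ℚᵘ./ (b ℕ.* d)      ≃⟨ toℚᵘ-fromℚᵘ (⁺ (a ℕ.* d ℕ.+ c ℕ.* b) ℚᵘ./ (b ℕ.* d)) ⟨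
  toℚᵘ (⁺ (a ℕ.* d ℕ.+ c ℕ.* b) / (b ℕ.* d)) ∎)
  where open ℚᵘ.≤-Reasoning

_/!_ : ℕ → ℕ → ℚ
a /! m = ⁺ a / m !
  where instance _ = m ℕ.!≢0

/!-cross : ∀ a m c n → a ℕ.* n ! ≡ c ℕ.* m ! → a /! m ≡ c /! n
/!-cross a m c n = /-cross a (m !) c (n !) {{m ℕ.!≢0}} {{n ℕ.!≢0}}

/!-+ : ∀ a b m → a /! m + b /! m ≡ (a ℕ.+ b) /! m
/!-+ a b m = trans (/-+ a (m !) b (m !) {{m ℕ.!≢0}} {{m ℕ.!≢0}})
  (/-cross (a ℕ.* m ! ℕ.+ b ℕ.* m !) (m ! ℕ.* m !) (a ℕ.+ b) (m !) {{ℕ.m*n≢0 (m !) (m !) {{m ℕ.!≢0}} {{m ℕ.!≢0}}}} {{m ℕ.!≢0}}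
    (solve 3 (λ a b d → (a :* d :+ b :* d) :* d := (a :+ b) :* (d :* d)) refl a b (m !)))
  where open ℕ-Solver.+-*-Solver

β : ℕ → ℕ → ℚ
β m k = ((m ∸ k) ! ℕ.* k !) /! suc m

β-≡ : ∀ {m k d} → m ∸ k ≡ d → β m k ≡ (d ! ℕ.* k !) /! suc m
β-≡ refl = refl

β-pascal-+ : ∀ k d → β (k ℕ.+ d) k ≡ β (suc (k ℕ.+ d)) k + β (suc (k ℕ.+ d)) (suc k)
β-pascal-+ k d = begin
  β m k                                                  ≡⟨ β-≡ {m} {k} (ℕ.m+n∸m≡n k d) ⟩
  (d ! ℕ.* k !) /! suc m                                 ≡⟨ /!-cross (d ! ℕ.* k !) (suc m) (A ℕ.+ B) (suc (suc m)) numerators ⟩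
  (A ℕ.+ B) /! suc (suc m)                               ≡⟨ /!-+ A B (suc (suc m)) ⟨
  A /! suc (suc m) + B /! suc (suc m)                    ≡⟨ cong₂ _+_ (β-≡ {suc m} {k} suc-m∸k) (β-≡ {suc m} {suc k} (ℕ.m+n∸m≡n k d)) ⟨
  β (suc m) k + β (suc m) (suc k)                        ∎
  where
  open ≡-Reasoning
  open ℕ-Solver.+-*-Solver
  m = k ℕ.+ d
  A = suc d ! ℕ.* k !
  B = d ! ℕ.* suc k !
  numerators : d ! ℕ.* k ! ℕ.* suc (suc m) ! ≡ (A ℕ.+ B) ℕ.* suc m !
  numerators = solve 5 (λ X Y F k d →
    X :* Y :* ((con 2 :+ k :+ d) :* F) := ((con 1 :+ d) :* X :* Y :+ X :* ((con 1 :+ k) :* Y)) :* F)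
    refl (d !) (k !) (suc m !) k d
  suc-m∸k : suc m ∸ k ≡ suc d
  suc-m∸k = trans (cong (_∸ k) (sym (ℕ.+-suc k d))) (ℕ.m+n∸m≡n k (suc d))

β-pascal : ∀ {m k} → k ≤ m → β m k ≡ β (suc m) k + β (suc m) (suc k)
β-pascal {m} {k} k≤m = subst (λ m → β m k ≡ β (suc m) k + β (suc m) (suc k))
  (ℕ.m+[n∸m]≡n k≤m) (β-pascal-+ k (m ∸ k))

β-diag : ∀ m → β m m ≡ ⁺ 1 / suc m
β-diag m = trans (β-≡ {m} {m} (ℕ.n∸n≡0 m))
  (/-cross (0 ! ℕ.* m !) (suc m !) 1 (suc m) {{suc m ℕ.!≢0}}
    (solve 2 (λ X m → con 1 :* X :* (con 1 :+ m) := con 1 :* ((con 1 :+ m) :* X)) refl (m !) m))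
  where open ℕ-Solver.+-*-Solver

∑-β-interval : ∀ n (I J : Subset n) {e q} → q ≤ e →
  ∑ n (λ K → ⟦ I ⊆? K ⟧ * ⟦ K ⊆? J ⟧ * β (e ℕ.+ ∣ J ∣) (q ℕ.+ ∣ K ∣))
  ≡ ⟦ I ⊆? J ⟧ * β (e ℕ.+ ∣ I ∣) (q ℕ.+ ∣ I ∣)
∑-β-interval zero    [] [] q≤e = refl
∑-β-interval (suc n) (outside ∷ I) (outside ∷ J) {e} {q} q≤e = begin
  ∑ n (λ K → ⟦ I ⊆? K ⟧ * ⟦ K ⊆? J ⟧ * β (e ℕ.+ ∣ J ∣) (q ℕ.+ ∣ K ∣))
    + ∑ n (λ K → ⟦ I ⊆? K ⟧ * 0ℚ * β (e ℕ.+ ∣ J ∣) (q ℕ.+ suc ∣ K ∣))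
    ≡⟨ cong₂ _+_ (∑-β-interval n I J q≤e) (∑-zero n (λ K → x*0*y≡0 ⟦ I ⊆? K ⟧ _)) ⟩
  ⟦ I ⊆? J ⟧ * β (e ℕ.+ ∣ I ∣) (q ℕ.+ ∣ I ∣) + 0ℚ
    ≡⟨ +-identityʳ _ ⟩
  ⟦ I ⊆? J ⟧ * β (e ℕ.+ ∣ I ∣) (q ℕ.+ ∣ I ∣) ∎
  where open ≡-Reasoning
∑-β-interval (suc n) (outside ∷ I) (inside ∷ J) {e} {q} q≤e = begin
  ∑ n (λ K → ⟦ I ⊆? K ⟧ * ⟦ K ⊆? J ⟧ * β (e ℕ.+ suc ∣ J ∣) (q ℕ.+ ∣ K ∣))
    + ∑ n (λ K → ⟦ I ⊆? K ⟧ * ⟦ K ⊆? J ⟧ * β (e ℕ.+ suc ∣ J ∣) (q ℕ.+ suc ∣ K ∣))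
    ≡⟨ cong₂ _+_ (∑-cong n (λ K → cong (λ x → ⟦ I ⊆? K ⟧ * ⟦ K ⊆? J ⟧ * β x (q ℕ.+ ∣ K ∣)) (ℕ.+-suc e ∣ J ∣)))
                 (∑-cong n (λ K → cong₂ (λ x y → ⟦ I ⊆? K ⟧ * ⟦ K ⊆? J ⟧ * β x y) (ℕ.+-suc e ∣ J ∣) (ℕ.+-suc q ∣ K ∣))) ⟩
  ∑ n (λ K → ⟦ I ⊆? K ⟧ * ⟦ K ⊆? J ⟧ * β (suc e ℕ.+ ∣ J ∣) (q ℕ.+ ∣ K ∣))
    + ∑ n (λ K → ⟦ I ⊆? K ⟧ * ⟦ K ⊆? J ⟧ * β (suc e ℕ.+ ∣ J ∣) (suc q ℕ.+ ∣ K ∣))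
    ≡⟨ cong₂ _+_ (∑-β-interval n I J (ℕ.m≤n⇒m≤1+n q≤e)) (∑-β-interval n I J (s≤s q≤e)) ⟩
  ⟦ I ⊆? J ⟧ * β (suc (e ℕ.+ ∣ I ∣)) (q ℕ.+ ∣ I ∣) + ⟦ I ⊆? J ⟧ * β (suc (e ℕ.+ ∣ I ∣)) (suc (q ℕ.+ ∣ I ∣))
    ≡⟨ *-distribˡ-+ ⟦ I ⊆? J ⟧ _ _ ⟨
  ⟦ I ⊆? J ⟧ * (β (suc (e ℕ.+ ∣ I ∣)) (q ℕ.+ ∣ I ∣) + β (suc (e ℕ.+ ∣ I ∣)) (suc (q ℕ.+ ∣ I ∣)))
    ≡⟨ cong (⟦ I ⊆? J ⟧ *_) (β-pascal (ℕ.+-monoˡ-≤ ∣ I ∣ q≤e)) ⟨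
  ⟦ I ⊆? J ⟧ * β (e ℕ.+ ∣ I ∣) (q ℕ.+ ∣ I ∣) ∎
  where open ≡-Reasoning
∑-β-interval (suc n) (inside ∷ I) (inside ∷ J) {e} {q} q≤e = begin
  ∑ n (λ K → 0ℚ * ⟦ K ⊆? J ⟧ * β (e ℕ.+ suc ∣ J ∣) (q ℕ.+ ∣ K ∣))
    + ∑ n (λ K → ⟦ I ⊆? K ⟧ * ⟦ K ⊆? J ⟧ * β (e ℕ.+ suc ∣ J ∣) (q ℕ.+ suc ∣ K ∣))
    ≡⟨ cong₂ _+_ (∑-zero n (λ K → 0*x*y≡0 ⟦ K ⊆? J ⟧ _))
                 (∑-cong n (λ K → cong₂ (λ x y → ⟦ I ⊆? K ⟧ * ⟦ K ⊆? J ⟧ * β x y) (ℕ.+-suc e ∣ J ∣) (ℕ.+-suc q ∣ K ∣))) ⟩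
  0ℚ + ∑ n (λ K → ⟦ I ⊆? K ⟧ * ⟦ K ⊆? J ⟧ * β (suc e ℕ.+ ∣ J ∣) (suc q ℕ.+ ∣ K ∣))
    ≡⟨ trans (+-identityˡ _) (∑-β-interval n I J (s≤s q≤e)) ⟩
  ⟦ I ⊆? J ⟧ * β (suc e ℕ.+ ∣ I ∣) (suc q ℕ.+ ∣ I ∣)
    ≡⟨ cong₂ (λ x y → ⟦ I ⊆? J ⟧ * β x y) (ℕ.+-suc e ∣ I ∣) (ℕ.+-suc q ∣ I ∣) ⟨
  ⟦ I ⊆? J ⟧ * β (e ℕ.+ suc ∣ I ∣) (q ℕ.+ suc ∣ I ∣) ∎
  where open ≡-Reasoning
∑-β-interval (suc n) (inside ∷ I) (outside ∷ J) {e} {q} q≤e = begin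
  ∑ n (λ K → 0ℚ * ⟦ K ⊆? J ⟧ * β (e ℕ.+ ∣ J ∣) (q ℕ.+ ∣ K ∣))
    + ∑ n (λ K → ⟦ I ⊆? K ⟧ * 0ℚ * β (e ℕ.+ ∣ J ∣) (q ℕ.+ suc ∣ K ∣))
    ≡⟨ cong₂ _+_ (∑-zero n (λ K → 0*x*y≡0 ⟦ K ⊆? J ⟧ _)) (∑-zero n (λ K → x*0*y≡0 ⟦ I ⊆? K ⟧ _)) ⟩
  0ℚ + 0ℚ
    ≡⟨ *-zeroˡ (β (e ℕ.+ suc ∣ I ∣) (q ℕ.+ suc ∣ I ∣)) ⟨
  0ℚ * β (e ℕ.+ suc ∣ I ∣) (q ℕ.+ suc ∣ I ∣) ∎
  where open ≡-Reasoning

-- Möbius expansion of Δ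

sign-+ : ∀ a b → sign (a ℕ.+ b) ≡ sign a * sign b
sign-+ zero    b = sym (*-identityˡ (sign b))
sign-+ (suc a) b = trans (cong -_ (sign-+ a b)) (neg-distribˡ-* (sign a) (sign b))

sign-suc-∸ : ∀ {a b} → b ≤ a → sign (suc a ∸ b) ≡ - sign (a ∸ b)
sign-suc-∸ {a} b≤a = cong sign (ℕ.+-∸-assoc 1 b≤a)

infix 4 _≟ₛ_
_≟ₛ_ : ∀ {n} → DecidableEquality (Subset n)
_≟ₛ_ = ≡-dec _≟ᵇ_

∑-sign-interval : ∀ n (D S : Subset n) →
  ∑ n (λ X → ⟦ D ⊆? X ⟧ * (⟦ X ⊆? S ⟧ * sign (∣ S ∣ ∸ ∣ X ∣))) ≡ ⟦ D ≟ₛ S ⟧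
∑-sign-interval zero    [] [] = *-identityˡ _
∑-sign-interval (suc n) (outside ∷ D) (outside ∷ S) = begin
  ∑ n (λ X → ⟦ D ⊆? X ⟧ * (⟦ X ⊆? S ⟧ * sign (∣ S ∣ ∸ ∣ X ∣))) + ∑ n (λ X → ⟦ D ⊆? X ⟧ * (0ℚ * sign (∣ S ∣ ∸ suc ∣ X ∣)))
    ≡⟨ cong₂ _+_ (∑-sign-interval n D S) (∑-zero n (λ X → x*[0*y]≡0 ⟦ D ⊆? X ⟧ (sign (∣ S ∣ ∸ suc ∣ X ∣)))) ⟩
  ⟦ D ≟ₛ S ⟧ + 0ℚ
    ≡⟨ +-identityʳ _ ⟩
  ⟦ D ≟ₛ S ⟧ ∎
  where open ≡-Reasoning
∑-sign-interval (suc n) (outside ∷ D) (inside ∷ S) = begin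
  ∑ n (λ X → ⟦ D ⊆? X ⟧ * (⟦ X ⊆? S ⟧ * sign (suc ∣ S ∣ ∸ ∣ X ∣))) + ∑ n (λ X → ⟦ D ⊆? X ⟧ * (⟦ X ⊆? S ⟧ * sign (∣ S ∣ ∸ ∣ X ∣)))
    ≡⟨ cong (_+ ∑ n f) (∑-cong n flip-sign) ⟩
  ∑ n (λ X → - f X) + ∑ n f
    ≡⟨ cong (_+ ∑ n f) (∑-neg n f) ⟩
  - ∑ n f + ∑ n f
    ≡⟨ +-inverseˡ (∑ n f) ⟩
  0ℚ ∎
  where
  open ≡-Reasoning
  f : Subset n → ℚ
  f X = ⟦ D ⊆? X ⟧ * (⟦ X ⊆? S ⟧ * sign (∣ S ∣ ∸ ∣ X ∣))
  flip-sign : ∀ X → ⟦ D ⊆? X ⟧ * (⟦ X ⊆? S ⟧ * sign (suc ∣ S ∣ ∸ ∣ X ∣)) ≡ - f X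
  flip-sign X = begin
    ⟦ D ⊆? X ⟧ * (⟦ X ⊆? S ⟧ * sign (suc ∣ S ∣ ∸ ∣ X ∣))
      ≡⟨ cong (⟦ D ⊆? X ⟧ *_) (⟦⟧-under (X ⊆? S) (λ X⊆S → sign-suc-∸ (p⊆q⇒∣p∣≤∣q∣ X⊆S))) ⟩
    ⟦ D ⊆? X ⟧ * (⟦ X ⊆? S ⟧ * - sign (∣ S ∣ ∸ ∣ X ∣))
      ≡⟨ cong (⟦ D ⊆? X ⟧ *_) (neg-distribʳ-* ⟦ X ⊆? S ⟧ _) ⟨
    ⟦ D ⊆? X ⟧ * - (⟦ X ⊆? S ⟧ * sign (∣ S ∣ ∸ ∣ X ∣))
      ≡⟨ neg-distribʳ-* ⟦ D ⊆? X ⟧ _ ⟨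
    - f X ∎
∑-sign-interval (suc n) (inside ∷ D) (outside ∷ S) = begin
  ∑ n (λ X → 0ℚ * (⟦ X ⊆? S ⟧ * sign (∣ S ∣ ∸ ∣ X ∣))) + ∑ n (λ X → ⟦ D ⊆? X ⟧ * (0ℚ * sign (∣ S ∣ ∸ suc ∣ X ∣)))
    ≡⟨ cong₂ _+_ (∑-zero n (λ X → *-zeroˡ (⟦ X ⊆? S ⟧ * sign (∣ S ∣ ∸ ∣ X ∣)))) (∑-zero n (λ X → x*[0*y]≡0 ⟦ D ⊆? X ⟧ (sign (∣ S ∣ ∸ suc ∣ X ∣)))) ⟩
  0ℚ + 0ℚ ∎
  where open ≡-Reasoning
∑-sign-interval (suc n) (inside ∷ D) (inside ∷ S) = begin
  ∑ n (λ X → 0ℚ * (⟦ X ⊆? S ⟧ * sign (suc ∣ S ∣ ∸ ∣ X ∣))) + ∑ n (λ X → ⟦ D ⊆? X ⟧ * (⟦ X ⊆? S ⟧ * sign (∣ S ∣ ∸ ∣ X ∣)))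
    ≡⟨ cong (_+ ∑ n (λ X → ⟦ D ⊆? X ⟧ * (⟦ X ⊆? S ⟧ * sign (∣ S ∣ ∸ ∣ X ∣)))) (∑-zero n (λ X → *-zeroˡ (⟦ X ⊆? S ⟧ * sign (suc ∣ S ∣ ∸ ∣ X ∣)))) ⟩
  0ℚ + ∑ n (λ X → ⟦ D ⊆? X ⟧ * (⟦ X ⊆? S ⟧ * sign (∣ S ∣ ∸ ∣ X ∣)))
    ≡⟨ trans (+-identityˡ _) (∑-sign-interval n D S) ⟩
  ⟦ D ≟ₛ S ⟧ ∎
  where open ≡-Reasoning

⊆?-∪-─ : ∀ {n} (A C X : Subset n) → does (A ⊆? C ∪ X) ≡ does (A ─ C ⊆? X)
⊆?-∪-─ []            []            []            = refl
⊆?-∪-─ (outside ∷ A) (outside ∷ C) (_       ∷ X) = ⊆?-∪-─ A C X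
⊆?-∪-─ (outside ∷ A) (inside  ∷ C) (_       ∷ X) = ⊆?-∪-─ A C X
⊆?-∪-─ (inside  ∷ A) (inside  ∷ C) (_       ∷ X) = ⊆?-∪-─ A C X
⊆?-∪-─ (inside  ∷ A) (outside ∷ C) (inside  ∷ X) = ⊆?-∪-─ A C X
⊆?-∪-─ (inside  ∷ A) (outside ∷ C) (outside ∷ X) = refl

─-⊆?-swap : ∀ {n} (A X C : Subset n) → does (A ─ X ⊆? C) ≡ does (A ─ C ⊆? X)
─-⊆?-swap A X C = begin
  does (A ─ X ⊆? C) ≡⟨ ⊆?-∪-─ A X C ⟨
  does (A ⊆? X ∪ C) ≡⟨ cong (λ Y → does (A ⊆? Y)) (∪-comm X C) ⟩
  does (A ⊆? C ∪ X) ≡⟨ ⊆?-∪-─ A C X ⟩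
  does (A ─ C ⊆? X) ∎
  where open ≡-Reasoning

∪-─-disjoint : ∀ {n} (K S′ S T′ : Subset n) → S′ ⊆ S → Disjoint (K ∪ S′) (∁ (K ∪ S) ─ T′)
∪-─-disjoint K S′ S T′ S′⊆S = Empty-unique λ (x , x∈∩) →
  let x∈K∪S′ , x∈L = x∈p∩q⁻ (K ∪ S′) (∁ (K ∪ S) ─ T′) x∈∩
  in x∈p⇒x∉∁p (K∪S′⊆K∪S x∈K∪S′) (p─q⊆p (∁ (K ∪ S)) T′ x∈L)
  where
  K∪S′⊆K∪S : K ∪ S′ ⊆ K ∪ S
  K∪S′⊆K∪S = [ x∈p∪q⁺ ∘ inj₁ , x∈p∪q⁺ ∘ inj₂ ∘ S′⊆S ]′ ∘ x∈p∪q⁻ K S′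

module _ {n} {v m : Game n} (mob : IsMobius v m) (S T K : Subset n) where

  private
    L : Subset n
    L = ∁ (K ∪ S)

    φ : Subset n → Subset n → Subset n → ℚ
    φ R D X = ⟦ D ⊆? X ⟧ * (⟦ X ⊆? R ⟧ * sign (∣ R ∣ ∸ ∣ X ∣))

    expand-term : ∀ S′ T′ →
      ⟦ (S′ ⊆? S) ×-dec (T′ ⊆? T) ⟧ * (sign ((∣ S ∣ ∸ ∣ S′ ∣) ℕ.+ (∣ T ∣ ∸ ∣ T′ ∣)) * v (K ∪ S′) (L ─ T′))
      ≡ ∑² n (λ B B′ → φ S (B ─ K) S′ * φ T (L ─ B′) T′ * (⟦ disjoint? B B′ ⟧ * m B B′))
    expand-term S′ T′ = begin
      ⟦ S′T′? ⟧ * (σ * v (K ∪ S′) (L ─ T′))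
        ≡⟨ ⟦⟧-under S′T′? (λ (S′⊆S , _) → cong (σ *_) (trans (mob (K ∪ S′) (L ─ T′) (∪-─-disjoint K S′ S T′ S′⊆S))
                                                              (sumOver-∑² n _ _))) ⟩
      ⟦ S′T′? ⟧ * (σ * ∑² n (λ B B′ → ⟦ inQ? (B , B′) ×-dec ((B , B′) ⊑? (K ∪ S′ , L ─ T′)) ⟧ * m B B′))
        ≡⟨ trans (cong (⟦ S′T′? ⟧ *_) (∑²-*ˡ n σ _)) (∑²-*ˡ n ⟦ S′T′? ⟧ _) ⟩
      ∑² n (λ B B′ → ⟦ S′T′? ⟧ * (σ * (⟦ inQ? (B , B′) ×-dec ((B , B′) ⊑? (K ∪ S′ , L ─ T′)) ⟧ * m B B′)))
        ≡⟨ ∑²-cong n summand ⟩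
      ∑² n (λ B B′ → φ S (B ─ K) S′ * φ T (L ─ B′) T′ * (⟦ disjoint? B B′ ⟧ * m B B′)) ∎
      where
      open ≡-Reasoning
      S′T′? = (S′ ⊆? S) ×-dec (T′ ⊆? T)
      σ = sign ((∣ S ∣ ∸ ∣ S′ ∣) ℕ.+ (∣ T ∣ ∸ ∣ T′ ∣))
      summand : ∀ B B′ → ⟦ S′T′? ⟧ * (σ * (⟦ inQ? (B , B′) ×-dec ((B , B′) ⊑? (K ∪ S′ , L ─ T′)) ⟧ * m B B′))
                      ≡ φ S (B ─ K) S′ * φ T (L ─ B′) T′ * (⟦ disjoint? B B′ ⟧ * m B B′)
      summand B B′ = begin
        ⟦ S′T′? ⟧ * (σ * (⟦ inQ? (B , B′) ×-dec ((B , B′) ⊑? (K ∪ S′ , L ─ T′)) ⟧ * m B B′))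
          ≡⟨ cong₂ (λ x y → x * y) (χ-∧ (does (S′ ⊆? S)) (does (T′ ⊆? T)))
               (cong₂ (λ x y → x * (y * m B B′)) (sign-+ (∣ S ∣ ∸ ∣ S′ ∣) (∣ T ∣ ∸ ∣ T′ ∣))
                 (trans (χ-∧ (does (disjoint? B B′)) _) (cong (⟦ disjoint? B B′ ⟧ *_)
                   (trans (χ-∧ (does (B ⊆? K ∪ S′)) (does (L ─ T′ ⊆? B′)))
                          (cong₂ (λ x y → χ x * χ y) (⊆?-∪-─ B K S′) (─-⊆?-swap L T′ B′)))))) ⟩
        ⟦ S′ ⊆? S ⟧ * ⟦ T′ ⊆? T ⟧ * (sign (∣ S ∣ ∸ ∣ S′ ∣) * sign (∣ T ∣ ∸ ∣ T′ ∣)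
          * (⟦ disjoint? B B′ ⟧ * (⟦ B ─ K ⊆? S′ ⟧ * ⟦ L ─ B′ ⊆? T′ ⟧) * m B B′))
          ≡⟨ rearrange ⟦ S′ ⊆? S ⟧ ⟦ T′ ⊆? T ⟧ (sign (∣ S ∣ ∸ ∣ S′ ∣)) (sign (∣ T ∣ ∸ ∣ T′ ∣))
               ⟦ disjoint? B B′ ⟧ ⟦ B ─ K ⊆? S′ ⟧ ⟦ L ─ B′ ⊆? T′ ⟧ (m B B′) ⟩
        φ S (B ─ K) S′ * φ T (L ─ B′) T′ * (⟦ disjoint? B B′ ⟧ * m B B′) ∎
        where
        open ℚ-Solver.+-*-Solver using (solve; _:*_; _:=_)
        rearrange : ∀ a b c d e f g h → a * b * (c * d * (e * (f * g) * h)) ≡ f * (a * c) * (g * (b * d)) * (e * h)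
        rearrange = solve 8 (λ a b c d e f g h →
          a :* b :* (c :* d :* (e :* (f :* g) :* h)) := f :* (a :* c) :* (g :* (b :* d)) :* (e :* h)) refl

  Δ-möbius : Δ S T v K L ≡ ∑² n (λ B B′ → ⟦ B ─ K ≟ₛ S ⟧ * ⟦ L ─ B′ ≟ₛ T ⟧ * (⟦ disjoint? B B′ ⟧ * m B B′))
  Δ-möbius = begin
    Δ S T v K L
      ≡⟨ sumOver-∑² n _ _ ⟩
    ∑² n (λ S′ T′ → ⟦ (S′ ⊆? S) ×-dec (T′ ⊆? T) ⟧ * (sign ((∣ S ∣ ∸ ∣ S′ ∣) ℕ.+ (∣ T ∣ ∸ ∣ T′ ∣)) * v (K ∪ S′) (L ─ T′)))
      ≡⟨ ∑²-cong n expand-term ⟩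
    ∑² n (λ S′ T′ → ∑² n (λ B B′ → φ S (B ─ K) S′ * φ T (L ─ B′) T′ * (⟦ disjoint? B B′ ⟧ * m B B′)))
      ≡⟨ ∑²-comm n _ ⟩
    ∑² n (λ B B′ → ∑² n (λ S′ T′ → φ S (B ─ K) S′ * φ T (L ─ B′) T′ * (⟦ disjoint? B B′ ⟧ * m B B′)))
      ≡⟨ ∑²-cong n (λ B B′ → trans (∑-cong n (λ S′ → sym (∑-*ʳ n _ _))) (trans (sym (∑-*ʳ n _ _))
           (cong (_* _) (∑²-product n (φ S (B ─ K)) (φ T (L ─ B′)))))) ⟩
    ∑² n (λ B B′ → ∑ n (φ S (B ─ K)) * ∑ n (φ T (L ─ B′)) * (⟦ disjoint? B B′ ⟧ * m B B′))
      ≡⟨ ∑²-cong n (λ B B′ → cong₂ (λ x y → x * y * (⟦ disjoint? B B′ ⟧ * m B B′))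
           (∑-sign-interval n (B ─ K) S) (∑-sign-interval n (L ─ B′) T)) ⟩
    ∑² n (λ B B′ → ⟦ B ─ K ≟ₛ S ⟧ * ⟦ L ─ B′ ≟ₛ T ⟧ * (⟦ disjoint? B B′ ⟧ * m B B′)) ∎
    where open ≡-Reasoning

-- Coordinatewise comparison of the conditions on (B, B′, K)

_∈[_,_]? : ∀ {n} (x a b : Pair n) → Dec (InQ x × (a ⊑ x × x ⊑ b))
x ∈[ a , b ]? = inQ? x ×-dec ((a ⊑? x) ×-dec (x ⊑? b))

infixr 6 _∧-split_

-- The splitting is carried as data: unification cannot solve a constraint ?a ∧ ?b = c ∧ d.
record ∧-Split (x : Bool) : Set where
  constructor split
  field
    first rest : Bool
    eq : x ≡ first ∧ rest

_∧-split_ : ∀ {x y} → ∧-Split x → ∧-Split y → ∧-Split (x ∧ y)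
split h t x≡h∧t ∧-split split h′ t′ y≡h′∧t′ =
  split (h ∧ h′) (t ∧ t′) (trans (cong₂ _∧_ x≡h∧t y≡h′∧t′) (interchange h t h′ t′))
  where open import Algebra.Properties.CommutativeSemigroup (CommutativeMonoid.commutativeSemigroup ∧-commutativeMonoid)

⊆?-split : ∀ {n} (X Y : Subset (suc n)) → ∧-Split (does (X ⊆? Y))
⊆?-split X Y = split (does (head X ∷ [] ⊆? head Y ∷ [])) (does (tail X ⊆? tail Y)) (⊆?-∷ X Y)
  where
  ⊆?-∷ : ∀ {n} (X Y : Subset (suc n)) → does (X ⊆? Y) ≡ does (head X ∷ [] ⊆? head Y ∷ []) ∧ does (tail X ⊆? tail Y)
  ⊆?-∷ (outside ∷ _) (_       ∷ _) = refl
  ⊆?-∷ (inside  ∷ _) (outside ∷ _) = refl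
  ⊆?-∷ (inside  ∷ _) (inside  ∷ _) = refl

≟ₛ-split : ∀ {n} (X Y : Subset (suc n)) → ∧-Split (does (X ≟ₛ Y))
≟ₛ-split (x ∷ X) (y ∷ Y) =
  split (does (x ∷ [] ≟ₛ y ∷ [])) (does (X ≟ₛ Y)) (cong (_∧ does (X ≟ₛ Y)) (sym (∧-identityʳ (does (x ≟ᵇ y)))))

Δ-condition : ∀ {n} (S T B B′ K : Subset n) → Bool
Δ-condition S T B B′ K =
  does (K ⊆? ∁ (S ∪ T)) ∧ does (B ─ K ≟ₛ S) ∧ does (∁ (K ∪ S) ─ B′ ≟ₛ T) ∧ does (disjoint? B B′)

interval-condition : ∀ {n} (S T B B′ K : Subset n) → Bool
interval-condition S T B B′ K =
  does ((B , B′) ∈[ (S , ∁ (S ∪ T)) , (∁ T , ⊥) ]?) ∧ does (∁ ((S ∪ T) ∪ B′) ⊆? K) ∧ does (K ⊆? ∁ (S ∪ T))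

Δ-condition-∷ : ∀ {n} (S T B B′ K : Subset (suc n)) →
  Δ-condition S T B B′ K
  ≡ Δ-condition [ head S ] [ head T ] [ head B ] [ head B′ ] [ head K ] ∧ Δ-condition (tail S) (tail T) (tail B) (tail B′) (tail K)
Δ-condition-∷ S@(_ ∷ _) T@(_ ∷ _) B@(_ ∷ _) B′@(_ ∷ _) K@(_ ∷ _) = ∧-Split.eq
  (⊆?-split K (∁ (S ∪ T)) ∧-split ≟ₛ-split (B ─ K) S ∧-split ≟ₛ-split (∁ (K ∪ S) ─ B′) T ∧-split ≟ₛ-split (B ∩ B′) ⊥)

interval-condition-∷ : ∀ {n} (S T B B′ K : Subset (suc n)) →
  interval-condition S T B B′ K
  ≡ interval-condition [ head S ] [ head T ] [ head B ] [ head B′ ] [ head K ] ∧ interval-condition (tail S) (tail T) (tail B) (tail B′) (tail K)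
interval-condition-∷ S@(_ ∷ _) T@(_ ∷ _) B@(_ ∷ _) B′@(_ ∷ _) K@(_ ∷ _) = ∧-Split.eq
  ((≟ₛ-split (B ∩ B′) ⊥ ∧-split (⊆?-split S B ∧-split ⊆?-split B′ (∁ (S ∪ T))) ∧-split ⊆?-split B (∁ T) ∧-split ⊆?-split ⊥ B′)
   ∧-split ⊆?-split (∁ ((S ∪ T) ∪ B′)) K ∧-split ⊆?-split K (∁ (S ∪ T)))

Δ-condition≡interval-condition-[] : ∀ s t b b′ k → Disjoint (s ∷ []) (t ∷ []) →
  Δ-condition (s ∷ []) (t ∷ []) (b ∷ []) (b′ ∷ []) (k ∷ []) ≡ interval-condition (s ∷ []) (t ∷ []) (b ∷ []) (b′ ∷ []) (k ∷ [])
Δ-condition≡interval-condition-[] outside outside outside outside outside _  = refl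
Δ-condition≡interval-condition-[] outside outside outside outside inside  _  = refl
Δ-condition≡interval-condition-[] outside outside outside inside  outside _  = refl
Δ-condition≡interval-condition-[] outside outside outside inside  inside  _  = refl
Δ-condition≡interval-condition-[] outside outside inside  outside outside _  = refl
Δ-condition≡interval-condition-[] outside outside inside  outside inside  _  = refl
Δ-condition≡interval-condition-[] outside outside inside  inside  outside _  = refl
Δ-condition≡interval-condition-[] outside outside inside  inside  inside  _  = refl
Δ-condition≡interval-condition-[] outside inside  outside outside outside _  = refl
Δ-condition≡interval-condition-[] outside inside  outside outside inside  _  = refl
Δ-condition≡interval-condition-[] outside inside  outside inside  outside _  = refl
Δ-condition≡interval-condition-[] outside inside  outside inside  inside  _  = refl
Δ-condition≡interval-condition-[] outside inside  inside  outside outside _  = refl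
Δ-condition≡interval-condition-[] outside inside  inside  outside inside  _  = refl
Δ-condition≡interval-condition-[] outside inside  inside  inside  outside _  = refl
Δ-condition≡interval-condition-[] outside inside  inside  inside  inside  _  = refl
Δ-condition≡interval-condition-[] inside  outside outside outside outside _  = refl
Δ-condition≡interval-condition-[] inside  outside outside outside inside  _  = refl
Δ-condition≡interval-condition-[] inside  outside outside inside  outside _  = refl
Δ-condition≡interval-condition-[] inside  outside outside inside  inside  _  = refl
Δ-condition≡interval-condition-[] inside  outside inside  outside outside _  = refl
Δ-condition≡interval-condition-[] inside  outside inside  outside inside  _  = refl
Δ-condition≡interval-condition-[] inside  outside inside  inside  outside _  = refl
Δ-condition≡interval-condition-[] inside  outside inside  inside  inside  _  = refl
Δ-condition≡interval-condition-[] inside  inside  _       _       _       ()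

Δ-condition≡interval-condition : ∀ {n} (S T B B′ K : Subset n) → Disjoint S T →
  Δ-condition S T B B′ K ≡ interval-condition S T B B′ K
Δ-condition≡interval-condition [] [] [] [] [] _ = refl
Δ-condition≡interval-condition (s ∷ S) (t ∷ T) (b ∷ B) (b′ ∷ B′) (k ∷ K) S∩T≡⊥ = begin
  Δ-condition (s ∷ S) (t ∷ T) (b ∷ B) (b′ ∷ B′) (k ∷ K)
    ≡⟨ Δ-condition-∷ (s ∷ S) (t ∷ T) (b ∷ B) (b′ ∷ B′) (k ∷ K) ⟩
  Δ-condition (s ∷ []) (t ∷ []) (b ∷ []) (b′ ∷ []) (k ∷ []) ∧ Δ-condition S T B B′ K
    ≡⟨ cong₂ _∧_ (Δ-condition≡interval-condition-[] s t b b′ k (cong (_∷ []) s∧t≡false))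
                 (Δ-condition≡interval-condition S T B B′ K tail-disjoint) ⟩
  interval-condition (s ∷ []) (t ∷ []) (b ∷ []) (b′ ∷ []) (k ∷ []) ∧ interval-condition S T B B′ K
    ≡⟨ interval-condition-∷ (s ∷ S) (t ∷ T) (b ∷ B) (b′ ∷ B′) (k ∷ K) ⟨
  interval-condition (s ∷ S) (t ∷ T) (b ∷ B) (b′ ∷ B′) (k ∷ K) ∎
  where
  open ≡-Reasoning
  s∧t≡false = proj₁ (∷-injective S∩T≡⊥)
  tail-disjoint = proj₂ (∷-injective S∩T≡⊥)

∣p∪q∣≡∣p∣+∣q∣ : ∀ {n} (p q : Subset n) → Disjoint p q → ∣ p ∪ q ∣ ≡ ∣ p ∣ ℕ.+ ∣ q ∣
∣p∪q∣≡∣p∣+∣q∣ []            []            _  = refl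
∣p∪q∣≡∣p∣+∣q∣ (outside ∷ p) (outside ∷ q) pq = ∣p∪q∣≡∣p∣+∣q∣ p q (cong tail pq)
∣p∪q∣≡∣p∣+∣q∣ (outside ∷ p) (inside  ∷ q) pq =
  trans (cong suc (∣p∪q∣≡∣p∣+∣q∣ p q (cong tail pq))) (sym (ℕ.+-suc ∣ p ∣ ∣ q ∣))
∣p∪q∣≡∣p∣+∣q∣ (inside  ∷ p) (outside ∷ q) pq = cong suc (∣p∪q∣≡∣p∣+∣q∣ p q (cong tail pq))
∣p∪q∣≡∣p∣+∣q∣ (inside  ∷ p) (inside  ∷ q) ()

∣∁[p∪q]∣ : ∀ {n} (p q : Subset n) → Disjoint p q → ∣ ∁ (p ∪ q) ∣ ≡ n ∸ ∣ p ∣ ∸ ∣ q ∣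
∣∁[p∪q]∣ {n} p q pq = begin
  ∣ ∁ (p ∪ q) ∣        ≡⟨ ∣∁p∣≡n∸∣p∣ (p ∪ q) ⟩
  n ∸ ∣ p ∪ q ∣        ≡⟨ cong (n ∸_) (∣p∪q∣≡∣p∣+∣q∣ p q pq) ⟩
  n ∸ (∣ p ∣ ℕ.+ ∣ q ∣) ≡⟨ ℕ.∸-+-assoc n ∣ p ∣ ∣ q ∣ ⟨
  n ∸ ∣ p ∣ ∸ ∣ q ∣    ∎
  where open ≡-Reasoning

⊆∁⇒Disjoint : ∀ {n} {p q : Subset n} → p ⊆ ∁ q → Disjoint q p
⊆∁⇒Disjoint {q = q} p⊆∁q = Empty-unique λ (x , x∈q∩p) →
  let x∈q , x∈p = x∈p∩q⁻ q _ x∈q∩p in x∈p⇒x∉∁p x∈q (p⊆∁q x∈p)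

∣∁[p∪q∪r]∣ : ∀ {n} (p q r : Subset n) → Disjoint p q → r ⊆ ∁ (p ∪ q) →
  ∣ ∁ ((p ∪ q) ∪ r) ∣ ≡ n ∸ ∣ p ∣ ∸ ∣ q ∣ ∸ ∣ r ∣
∣∁[p∪q∪r]∣ {n} p q r pq r⊆∁[p∪q] = begin
  ∣ ∁ ((p ∪ q) ∪ r) ∣            ≡⟨ ∣∁[p∪q]∣ (p ∪ q) r (⊆∁⇒Disjoint r⊆∁[p∪q]) ⟩
  n ∸ ∣ p ∪ q ∣ ∸ ∣ r ∣          ≡⟨ cong (λ x → n ∸ x ∸ ∣ r ∣) (∣p∪q∣≡∣p∣+∣q∣ p q pq) ⟩
  n ∸ (∣ p ∣ ℕ.+ ∣ q ∣) ∸ ∣ r ∣  ≡⟨ cong (_∸ ∣ r ∣) (ℕ.∸-+-assoc n ∣ p ∣ ∣ q ∣) ⟨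
  n ∸ ∣ p ∣ ∸ ∣ q ∣ ∸ ∣ r ∣      ∎
  where open ≡-Reasoning

-- The interaction index as a sum over an interval

module _ {n} {v m : Game n} (mob : IsMobius v m) (S T : Subset n) (S∩T≡⊥ : Disjoint S T) where

  private
    J : Subset n
    J = ∁ (S ∪ T)

    I : Subset n → Subset n
    I B′ = ∁ ((S ∪ T) ∪ B′)

    P? : (x : Pair n) → Dec _
    P? x = x ∈[ (S , J) , (∁ T , ⊥) ]?

    χ-∧⁴ : ∀ a b c d → χ (a ∧ b ∧ c ∧ d) ≡ χ a * (χ b * (χ c * χ d))
    χ-∧⁴ a b c d = trans (χ-∧ a _) (cong (χ a *_) (trans (χ-∧ b _) (cong (χ b *_) (χ-∧ c d))))

    summand : ∀ K B B′ →
      ⟦ K ⊆? J ⟧ * (β (n ∸ ∣ S ∣ ∸ ∣ T ∣) ∣ K ∣ * (⟦ B ─ K ≟ₛ S ⟧ * ⟦ ∁ (K ∪ S) ─ B′ ≟ₛ T ⟧ * (⟦ disjoint? B B′ ⟧ * m B B′)))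
      ≡ ⟦ P? (B , B′) ⟧ * m B B′ * (⟦ I B′ ⊆? K ⟧ * ⟦ K ⊆? J ⟧ * β ∣ J ∣ ∣ K ∣)
    summand K B B′ = begin
      ⟦ K ⊆? J ⟧ * (β₀ * (⟦ B ─ K ≟ₛ S ⟧ * ⟦ ∁ (K ∪ S) ─ B′ ≟ₛ T ⟧ * (⟦ disjoint? B B′ ⟧ * m B B′)))
        ≡⟨ gather ⟦ K ⊆? J ⟧ β₀ ⟦ B ─ K ≟ₛ S ⟧ ⟦ ∁ (K ∪ S) ─ B′ ≟ₛ T ⟧ ⟦ disjoint? B B′ ⟧ (m B B′) ⟩
      ⟦ K ⊆? J ⟧ * (⟦ B ─ K ≟ₛ S ⟧ * (⟦ ∁ (K ∪ S) ─ B′ ≟ₛ T ⟧ * ⟦ disjoint? B B′ ⟧)) * (m B B′ * β₀)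
        ≡⟨ cong (_* (m B B′ * β₀)) (sym (χ-∧⁴ (does (K ⊆? J)) (does (B ─ K ≟ₛ S)) (does (∁ (K ∪ S) ─ B′ ≟ₛ T)) (does (disjoint? B B′)))) ⟩
      χ (Δ-condition S T B B′ K) * (m B B′ * β₀)
        ≡⟨ cong (λ c → χ c * (m B B′ * β₀)) (Δ-condition≡interval-condition S T B B′ K S∩T≡⊥) ⟩
      χ (interval-condition S T B B′ K) * (m B B′ * β₀)
        ≡⟨ cong (_* (m B B′ * β₀)) (trans (χ-∧ (does (P? (B , B′))) _) (cong (⟦ P? (B , B′) ⟧ *_) (χ-∧ (does (I B′ ⊆? K)) _))) ⟩
      ⟦ P? (B , B′) ⟧ * (⟦ I B′ ⊆? K ⟧ * ⟦ K ⊆? J ⟧) * (m B B′ * β₀)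
        ≡⟨ scatter ⟦ P? (B , B′) ⟧ ⟦ I B′ ⊆? K ⟧ ⟦ K ⊆? J ⟧ (m B B′) β₀ ⟩
      ⟦ P? (B , B′) ⟧ * m B B′ * (⟦ I B′ ⊆? K ⟧ * ⟦ K ⊆? J ⟧ * β₀)
        ≡⟨ cong (λ x → ⟦ P? (B , B′) ⟧ * m B B′ * (⟦ I B′ ⊆? K ⟧ * ⟦ K ⊆? J ⟧ * β x ∣ K ∣)) (∣∁[p∪q]∣ S T S∩T≡⊥) ⟨
      ⟦ P? (B , B′) ⟧ * m B B′ * (⟦ I B′ ⊆? K ⟧ * ⟦ K ⊆? J ⟧ * β ∣ J ∣ ∣ K ∣) ∎
      where
      open ≡-Reasoning
      open ℚ-Solver.+-*-Solver using (solve; _:*_; _:=_)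
      β₀ = β (n ∸ ∣ S ∣ ∸ ∣ T ∣) ∣ K ∣
      gather : ∀ a b c d e f → a * (b * (c * d * (e * f))) ≡ a * (c * (d * e)) * (f * b)
      gather = solve 6 (λ a b c d e f → a :* (b :* (c :* d :* (e :* f))) := a :* (c :* (d :* e)) :* (f :* b)) refl
      scatter : ∀ p i k f b → p * (i * k) * (f * b) ≡ p * f * (i * k * b)
      scatter = solve 5 (λ p i k f b → p :* (i :* k) :* (f :* b) := p :* f :* (i :* k :* b)) refl

    interval-weight : ∀ B B′ →
      ⟦ P? (B , B′) ⟧ * m B B′ * (⟦ I B′ ⊆? J ⟧ * β (∣ I B′ ∣) (∣ I B′ ∣)) ≡ ⟦ P? (B , B′) ⟧ * term m S T (B , B′)
    interval-weight B B′ = trans (*-assoc ⟦ P? (B , B′) ⟧ (m B B′) _) (⟦⟧-under (P? (B , B′)) λ (_ , (_ , B′⊆J) , _) →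
      cong (m B B′ *_) (begin
        ⟦ I B′ ⊆? J ⟧ * β (∣ I B′ ∣) (∣ I B′ ∣)
          ≡⟨ cong (λ b → χ b * β (∣ I B′ ∣) (∣ I B′ ∣)) (dec-true (I B′ ⊆? J) (p⊆q⇒∁p⊇∁q (p⊆p∪q B′))) ⟩
        1ℚ * β (∣ I B′ ∣) (∣ I B′ ∣)
          ≡⟨ *-identityˡ _ ⟩
        β (∣ I B′ ∣) (∣ I B′ ∣)
          ≡⟨ β-diag (∣ I B′ ∣) ⟩
        ⁺ 1 / suc (∣ I B′ ∣)
          ≡⟨ cong (λ r → ⁺ 1 / suc r) (∣∁[p∪q∪r]∣ S T B′ S∩T≡⊥ B′⊆J) ⟩
        ⁺ 1 / suc (n ∸ ∣ S ∣ ∸ ∣ T ∣ ∸ ∣ B′ ∣) ∎))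
      where open ≡-Reasoning

  interaction≡∑-interval : interaction v S T ≡ sumOver P? (term m S T)
  interaction≡∑-interval = begin
    interaction v S T
      ≡⟨ trans (sumℚ-map-filter (_⊆? J) _ (allSubsets n)) (sumℚ-allSubsets n _) ⟩
    ∑ n (λ K → ⟦ K ⊆? J ⟧ * (β (n ∸ ∣ S ∣ ∸ ∣ T ∣) ∣ K ∣ * Δ S T v K (∁ (K ∪ S))))
      ≡⟨ ∑-cong n (λ K → cong (λ x → ⟦ K ⊆? J ⟧ * (β (n ∸ ∣ S ∣ ∸ ∣ T ∣) ∣ K ∣ * x)) (Δ-möbius mob S T K)) ⟩
    ∑ n (λ K → ⟦ K ⊆? J ⟧ * (β (n ∸ ∣ S ∣ ∸ ∣ T ∣) ∣ K ∣
               * ∑² n (λ B B′ → ⟦ B ─ K ≟ₛ S ⟧ * ⟦ ∁ (K ∪ S) ─ B′ ≟ₛ T ⟧ * (⟦ disjoint? B B′ ⟧ * m B B′))))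
      ≡⟨ ∑-cong n (λ K → trans (cong (⟦ K ⊆? J ⟧ *_) (∑²-*ˡ n (β (n ∸ ∣ S ∣ ∸ ∣ T ∣) ∣ K ∣) _)) (∑²-*ˡ n ⟦ K ⊆? J ⟧ _)) ⟩
    ∑ n (λ K → ∑² n (λ B B′ → ⟦ K ⊆? J ⟧ * (β (n ∸ ∣ S ∣ ∸ ∣ T ∣) ∣ K ∣
               * (⟦ B ─ K ≟ₛ S ⟧ * ⟦ ∁ (K ∪ S) ─ B′ ≟ₛ T ⟧ * (⟦ disjoint? B B′ ⟧ * m B B′)))))
      ≡⟨ ∑-cong n (λ K → ∑²-cong n (summand K)) ⟩
    ∑ n (λ K → ∑² n (λ B B′ → ⟦ P? (B , B′) ⟧ * m B B′ * (⟦ I B′ ⊆? K ⟧ * ⟦ K ⊆? J ⟧ * β ∣ J ∣ ∣ K ∣)))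
      ≡⟨ trans (∑-comm n n _) (∑-cong n (λ B → ∑-comm n n _)) ⟩
    ∑² n (λ B B′ → ∑ n (λ K → ⟦ P? (B , B′) ⟧ * m B B′ * (⟦ I B′ ⊆? K ⟧ * ⟦ K ⊆? J ⟧ * β ∣ J ∣ ∣ K ∣)))
      ≡⟨ ∑²-cong n (λ B B′ → trans (sym (∑-*ˡ n (⟦ P? (B , B′) ⟧ * m B B′) _))
                                   (cong (⟦ P? (B , B′) ⟧ * m B B′ *_) (∑-β-interval n (I B′) J z≤n))) ⟩
    ∑² n (λ B B′ → ⟦ P? (B , B′) ⟧ * m B B′ * (⟦ I B′ ⊆? J ⟧ * β (∣ I B′ ∣) (∣ I B′ ∣)))
      ≡⟨ ∑²-cong n interval-weight ⟩
    ∑² n (λ B B′ → ⟦ P? (B , B′) ⟧ * term m S T (B , B′))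
      ≡⟨ sumOver-∑² n P? (term m S T) ⟨
    sumOver P? (term m S T) ∎
    where open ≡-Reasoning

-- The join of the generators

shift : ∀ {n} → Pair n → Pair (suc n)
shift (A , B) = (outside ∷ A , inside ∷ B)

⨆-map-shift : ∀ {n} {X : Set} (g : X → Pair n) xs → ⨆ (map (shift ∘ g) xs) ≡ shift (⨆ (map g xs))
⨆-map-shift g List.[]       = refl
⨆-map-shift g (x List.∷ xs) = cong (shift (g x) ⊔_) (⨆-map-shift g xs)

elems-∷-suc : ∀ {n} x (S : Subset n) → filter (_∈? (x ∷ S)) (tabulate Fin.suc) ≡ map Fin.suc (elems S)
elems-∷-suc {n} x S = begin
  filter (_∈? (x ∷ S)) (tabulate Fin.suc)  ≡⟨ cong (filter (_∈? (x ∷ S))) (List.map-tabulate id Fin.suc) ⟨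
  filter (_∈? (x ∷ S)) (map Fin.suc (allFin n)) ≡⟨ filter-map-suc (allFin n) ⟩
  map Fin.suc (elems S)                          ∎
  where
  open ≡-Reasoning
  filter-map-suc : ∀ is → filter (_∈? (x ∷ S)) (map Fin.suc is) ≡ map Fin.suc (filter (_∈? S) is)
  filter-map-suc List.[]       = refl
  filter-map-suc (i List.∷ is) with does (i ∈? S)
  ... | true  = cong (Fin.suc i List.∷_) (filter-map-suc is)
  ... | false = filter-map-suc is

module _ (g : ∀ {n} → Fin n → Pair n) (g-suc : ∀ {n} (i : Fin n) → g (Fin.suc i) ≡ shift (g i)) where

  ⨆-elems-∷-suc : ∀ {n} x (S : Subset n) → ⨆ (map g (filter (_∈? (x ∷ S)) (tabulate Fin.suc))) ≡ shift (⨆ (map g (elems S)))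
  ⨆-elems-∷-suc x S = begin
    ⨆ (map g (filter (_∈? (x ∷ S)) (tabulate Fin.suc))) ≡⟨ cong (⨆ ∘ map g) (elems-∷-suc x S) ⟩
    ⨆ (map g (map Fin.suc (elems S)))                   ≡⟨ cong ⨆ (List.map-∘ (elems S)) ⟨
    ⨆ (map (g ∘ Fin.suc) (elems S))                     ≡⟨ cong ⨆ (List.map-cong g-suc (elems S)) ⟩
    ⨆ (map (shift ∘ g) (elems S))                       ≡⟨ ⨆-map-shift g (elems S) ⟩
    shift (⨆ (map g (elems S)))                         ∎
    where open ≡-Reasoning

⨆-singletons : ∀ {n} (S : Subset n) → ⨆ (map (λ i → (⁅ i ⁆ , ∁ ⁅ i ⁆)) (elems S)) ≡ (S , ∁ S)
⨆-singletons []            = refl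
⨆-singletons (outside ∷ S) = trans (⨆-elems-∷-suc (λ i → (⁅ i ⁆ , ∁ ⁅ i ⁆)) (λ _ → refl) outside S) (cong shift (⨆-singletons S))
⨆-singletons (inside  ∷ S) = trans
  (cong ((⁅ Fin.zero ⁆ , ∁ ⁅ Fin.zero ⁆) ⊔_) (trans (⨆-elems-∷-suc (λ i → (⁅ i ⁆ , ∁ ⁅ i ⁆)) (λ _ → refl) inside S) (cong shift (⨆-singletons S))))
  (cong₂ (λ A B → (inside ∷ A , outside ∷ B)) (∪-identityˡ S) (trans (cong (_∩ ∁ S) ¬⊥≈⊤) (∩-identityˡ (∁ S))))
  where open BooleanAlgebraProperties (∪-∩-booleanAlgebra _) using (¬⊥≈⊤)

⨆-co-singletons : ∀ {n} (T : Subset n) → ⨆ (map (λ j → (⊥ , ∁ ⁅ j ⁆)) (elems T)) ≡ (⊥ , ∁ T)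
⨆-co-singletons []            = refl
⨆-co-singletons (outside ∷ T) = trans (⨆-elems-∷-suc (λ j → (⊥ , ∁ ⁅ j ⁆)) (λ _ → refl) outside T) (cong shift (⨆-co-singletons T))
⨆-co-singletons (inside  ∷ T) = trans
  (cong ((⊥ , ∁ ⁅ Fin.zero ⁆) ⊔_) (trans (⨆-elems-∷-suc (λ j → (⊥ , ∁ ⁅ j ⁆)) (λ _ → refl) inside T) (cong shift (⨆-co-singletons T))))
  (cong₂ (λ A B → (outside ∷ A , outside ∷ B)) (∪-identityˡ ⊥) (trans (cong (_∩ ∁ T) ¬⊥≈⊤) (∩-identityˡ (∁ T))))
  where open BooleanAlgebraProperties (∪-∩-booleanAlgebra _) using (¬⊥≈⊤)

⨆-generators : ∀ {n} (S T : Subset n) →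
  ⨆ (map (λ i → (⁅ i ⁆ , ∁ ⁅ i ⁆)) (elems S)) ⊔ ⨆ (map (λ j → (⊥ , ∁ ⁅ j ⁆)) (elems T)) ≡ (S , ∁ (S ∪ T))
⨆-generators S T = trans (cong₂ _⊔_ (⨆-singletons S) (⨆-co-singletons T))
  (cong₂ _,_ (∪-identityʳ S) (sym (deMorgan₂ S T)))
  where open BooleanAlgebraProperties (∪-∩-booleanAlgebra _) using (deMorgan₂)

upset∩Q[∁T]≐interval : ∀ {n} (S T : Subset n) →
  (λ x → (S , ∁ (S ∪ T)) ⊑ x × InQOn (∁ T) x) ≐ (λ x → InQ x × ((S , ∁ (S ∪ T)) ⊑ x × x ⊑ (∁ T , ⊥)))
upset∩Q[∁T]≐interval S T =
  (λ (lower , B⊆∁T , _ , B∩B′≡⊥) → B∩B′≡⊥ , lower , B⊆∁T , ⊥⊆) ,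
  (λ (B∩B′≡⊥ , lower@(_ , B′⊆∁[S∪T]) , B⊆∁T , _) →
     lower , B⊆∁T , ⊆-trans B′⊆∁[S∪T] (p⊆q⇒∁p⊇∁q (q⊆p∪q S T)) , B∩B′≡⊥)

upset-sum≡interval-sum : ∀ {n} (S T : Subset n) (f : Pair n → ℚ) →
  sumOver (λ x → (⨆ (map (λ i → (⁅ i ⁆ , ∁ ⁅ i ⁆)) (elems S)) ⊔ ⨆ (map (λ j → (⊥ , ∁ ⁅ j ⁆)) (elems T))) ⊑? x
                 ×-dec inQOn? (∁ T) x) f
  ≡ sumOver (λ x → x ∈[ (S , ∁ (S ∪ T)) , (∁ T , ⊥) ]?) f
upset-sum≡interval-sum {n} S T f = trans
  (cong (λ j → sumOver (λ x → j ⊑? x ×-dec inQOn? (∁ T) x) f) (⨆-generators S T))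
  (cong (sumℚ ∘ map f) (List.filter-≐ _ _ (upset∩Q[∁T]≐interval S T) (allPairs n)))

proposition5 : (n : ℕ) (v m : Game n) → IsBiCoopGame v → IsMobius v m →
    (S T : Subset n) → Disjoint S T →
    (interaction v S T
       ≡ sumOver
           (λ x → (⨆ (map (λ i → (⁅ i ⁆ , ∁ ⁅ i ⁆)) (elems S))
                     ⊔ ⨆ (map (λ j → (⊥ , ∁ ⁅ j ⁆)) (elems T))) ⊑? x
                  ×-dec inQOn? (∁ T) x)
           (term m S T))
    × (sumOver
           (λ x → (⨆ (map (λ i → (⁅ i ⁆ , ∁ ⁅ i ⁆)) (elems S))
                     ⊔ ⨆ (map (λ j → (⊥ , ∁ ⁅ j ⁆)) (elems T))) ⊑? x
                  ×-dec inQOn? (∁ T) x)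
           (term m S T)
       ≡ sumOver
           (λ x → inQ? x ×-dec (((S , ∁ (S ∪ T)) ⊑? x) ×-dec (x ⊑? (∁ T , ⊥))))
           (term m S T))
proposition5 n v m _ mob S T S∩T≡⊥ =
  trans (interaction≡∑-interval mob S T S∩T≡⊥) (sym (upset-sum≡interval-sum S T (term m S T))) ,
  upset-sum≡interval-sum S T (term m S T)
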